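{- Let $G=(V,E)$ and $H=(W,F)$ be graphs with disjoint nonempty vertex sets. Then (1) $\mathrm{tcl}(G\,\dot\cup\, H)=\max(\mathrm{tcl}(G),\mathrm{tcl}(H))$, and (2) $\mathrm{tcl}(G\times H)=\min\big(\max(\mathrm{vcc}(G),\mathrm{tcl}(H)),\ \max(\mathrm{vcc}(H),\mathrm{tcl}(G))\big)$.
   Context: All graphs are finite, simple and undirected. $G\,\dot\cup\, H=(V\cup W,E\cup F)$ is the disjoint union and $G\times H=(V\cup W, E\cup F\cup\{vw: v\in V,w\in W\})$ is the join. For a graph $K$, $\mathrm{vcc}(K)$ is the minimum number of cliques of $K$ whose union is $V(K)$; for $X\subseteq V(K)$, $\mathrm{vcc}(X)$ is the minimum number of cliques of $K$ whose union is $X$. A tree decomposition of $K$ is a pair $(T,\{X_t\}_{t\in V(T)})$ with $T$ a tree and bags $X_t\subseteq V(K)$ such that every vertex lies in some bag, both endpoints of every edge lie in a common bag, and for every vertex $v$ the nodes $t$ with $v\in X_t$ induce a connected subtree. An augmented tree decomposition additionally assigns to each node $t$ a collection $C_t$ of cliques of $K$ whose union is $X_t$; its width is $\max_t|C_t|$. The tree-clique width $\mathrm{tcl}(K)$ is the minimum width of an augmented tree decomposition of $K$, i.e. the minimum over tree decompositions of $\max_t \mathrm{vcc}(X_t)$. -}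

module Defs where

open import Data.Nat using (ℕ; _+_; _≤_)
open import Data.Fin using (Fin; splitAt; _≟_)
open import Data.Bool using (Bool; true; false; _∧_; _∨_; not)
open import Data.Sum using (_⊎_; inj₁; inj₂)
open import Data.Product using (Σ; _×_; ∃; _,_)
open import Relation.Nullary using (¬_)
open import Relation.Nullary.Decidable using (⌊_⌋)
open import Relation.Binary.PropositionalEquality using (_≡_; _≢_; refl)

record Graph (n : ℕ) : Set where
  field
    adj    : Fin n → Fin n → Bool
    sym    : ∀ x y → adj x y ≡ adj y x
    irrefl : ∀ x → adj x x ≡ false
open Graph public

VSet : ℕ → Set
VSet n = Fin n → Bool

full : ∀ {n} → VSet n
full _ = true

-- Disjoint union and join.  Vertices of G come first (Fin m ↪ Fin (m+n)),
-- vertices of H after; the two vertex sets are disjoint by construction.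

combine : ∀ {m n} → (Fin m → Fin m → Bool) → (Fin n → Fin n → Bool) → Bool →
          Fin m ⊎ Fin n → Fin m ⊎ Fin n → Bool
combine g h b (inj₁ x) (inj₁ y) = g x y
combine g h b (inj₂ x) (inj₂ y) = h x y
combine g h b (inj₁ x) (inj₂ y) = b
combine g h b (inj₂ x) (inj₁ y) = b

private
  combine-sym : ∀ {m n} (G : Graph m) (H : Graph n) b x y →
                combine (adj G) (adj H) b x y ≡ combine (adj G) (adj H) b y x
  combine-sym G H b (inj₁ x) (inj₁ y) = sym G x y
  combine-sym G H b (inj₂ x) (inj₂ y) = sym H x y
  combine-sym G H b (inj₁ x) (inj₂ y) = refl
  combine-sym G H b (inj₂ x) (inj₁ y) = refl

  combine-irr : ∀ {m n} (G : Graph m) (H : Graph n) b x →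
                combine (adj G) (adj H) b x x ≡ false
  combine-irr G H b (inj₁ x) = irrefl G x
  combine-irr G H b (inj₂ x) = irrefl H x

glue : ∀ {m n} → Graph m → Graph n → Bool → Graph (m + n)
glue {m} G H b = record
  { adj    = λ x y → combine (adj G) (adj H) b (splitAt m x) (splitAt m y)
  ; sym    = λ x y → combine-sym G H b (splitAt m x) (splitAt m y)
  ; irrefl = λ x → combine-irr G H b (splitAt m x)
  }

_⊎ᴳ_ : ∀ {m n} → Graph m → Graph n → Graph (m + n)
G ⊎ᴳ H = glue G H false

_×ᴳ_ : ∀ {m n} → Graph m → Graph n → Graph (m + n)
G ×ᴳ H = glue G H true

data Walk {n} (R : Fin n → Fin n → Bool) (P : VSet n) : Fin n → Fin n → Set where
  here : ∀ {u} → P u ≡ true → Walk R P u u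
  step : ∀ {u w v} → P u ≡ true → R u w ≡ true → Walk R P w v → Walk R P u v

ConnectedOn : ∀ {n} → (Fin n → Fin n → Bool) → VSet n → Set
ConnectedOn R P = ∀ u v → P u ≡ true → P v ≡ true → Walk R P u v

deleteEdge : ∀ {n} → (Fin n → Fin n → Bool) → Fin n → Fin n → Fin n → Fin n → Bool
deleteEdge R a b x y =
  R x y ∧ not ((⌊ x ≟ a ⌋ ∧ ⌊ y ≟ b ⌋) ∨ (⌊ x ≟ b ⌋ ∧ ⌊ y ≟ a ⌋))

-- A tree: a connected graph in which every edge is a bridge
-- (minimally connected graph, i.e. connected and acyclic).
IsTree : ∀ {k} → Graph k → Set
IsTree T = ConnectedOn (adj T) full ×
           (∀ a b → adj T a b ≡ true → ¬ Walk (deleteEdge (adj T) a b) full a b)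

IsClique : ∀ {n} → Graph n → VSet n → Set
IsClique G C = ∀ x y → C x ≡ true → C y ≡ true → x ≢ y → adj G x y ≡ true

CliqueCover : ∀ {n} → Graph n → VSet n → ℕ → Set
CliqueCover {n} G X c =
  Σ (Fin c → VSet n) λ C →
    (∀ i → IsClique G (C i)) ×
    (∀ v → X v ≡ true → ∃ λ i → C i v ≡ true) ×
    (∀ v i → C i v ≡ true → X v ≡ true)

IsVccOf : ∀ {n} → Graph n → VSet n → ℕ → Set
IsVccOf G X c = CliqueCover G X c × (∀ c' → CliqueCover G X c' → c ≤ c')

IsVcc : ∀ {n} → Graph n → ℕ → Set
IsVcc G c = IsVccOf G full c

record TreeDecomposition {n} (G : Graph n) : Set where
  field
    k      : ℕ
    T      : Graph k
    isTree : IsTree T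
    bag    : Fin k → VSet n
    vertexCovered : ∀ v → ∃ λ t → bag t v ≡ true
    edgeCovered   : ∀ u v → adj G u v ≡ true → ∃ λ t → bag t u ≡ true × bag t v ≡ true
    subtree       : ∀ v → ConnectedOn (adj T) (λ t → bag t v)
open TreeDecomposition public

HasAugTDWidth≤ : ∀ {n} → Graph n → ℕ → Set
HasAugTDWidth≤ G w =
  Σ (TreeDecomposition G) λ D →
    ∀ t → Σ ℕ λ c → c ≤ w × CliqueCover G (bag D t) c

IsTcl : ∀ {n} → Graph n → ℕ → Set
IsTcl G w = HasAugTDWidth≤ G w × (∀ w' → HasAugTDWidth≤ G w' → w ≤ w')

-- A decomposition of an induced subgraph is obtained by restricting the bags, so tcl is monotone under
-- induced subgraphs; decompositions of G and H combine into one of G ∪̇ H by linking their trees with one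
-- edge, which settles (1).  For the join, adding V(G) to every bag of a decomposition of H gives width
-- max(vcc(G), tcl(H)), since a clique of G together with a clique of H is a clique of G × H.  Conversely,
-- some bag of every tree decomposition of G × H contains V(G) or V(H): otherwise each node t points to its
-- neighbour towards a bag containing an edge uw with u ∈ V(G), w ∈ V(H), both missing from X_t.  In a finite
-- tree some edge tt' is pointed at from both ends, and then a bag containing the edge between the vertex of
-- V(G) chosen at t and the vertex of V(H) chosen at t' would lie on both sides of tt'.

module Submission where

open import Defs hiding (sym)
open import Data.Bool using (Bool; true; false; _∧_; _∨_; not)
import Data.Bool as Bool
open import Data.Bool.Properties using (∧-comm; ∨-comm; ∧-conicalˡ; ∧-conicalʳ; ∧-zeroʳ; ¬-not)
open import Data.Empty using (⊥; ⊥-elim)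
open import Data.Fin using (Fin; zero; suc; _≟_; toℕ; splitAt; join; _↑ˡ_; _↑ʳ_)
open import Data.Fin.Properties
  using (any?; all?; ¬∀⟶∃¬; pigeonhole; ↑ˡ-injective; ↑ʳ-injective;
         splitAt-↑ˡ; splitAt-↑ʳ; splitAt⁻¹-↑ˡ; splitAt⁻¹-↑ʳ; splitAt-join; join-splitAt)
open import Data.Nat using (ℕ; zero; suc; _+_; _∸_; _≤_; _⊔_; _⊓_)
open import Data.Nat.GeneralisedArithmetic using (iterate)
open import Data.Nat.Properties
  using (n<1+n; +-suc; m≤n⇒∃[o]m+o≡n; m+[n∸m]≡n;
         ≤-trans; m≤m⊔n; m≤n⊔m; ⊔-monoʳ-≤; ⊔-lub; m⊓n≤m; m⊓n≤n; ⊓-sel)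
open import Data.Product using (Σ; _×_; ∃; ∃₂; _,_; proj₁; proj₂)
import Data.Product as Prod
open import Data.Sum using (_⊎_; inj₁; inj₂; [_,_]′; swap)
import Data.Sum as Sum
open import Data.Sum.Properties using (swap-involutive)
open import Function using (_∘_; id; const)
open import Relation.Nullary using (¬_; yes; no; Dec)
open import Relation.Nullary.Decidable using (⌊_⌋)
open import Relation.Binary.PropositionalEquality
  using (_≡_; _≢_; refl; sym; trans; cong; cong₂; subst; subst₂; module ≡-Reasoning)

IsBridge : ∀ {n} → (Fin n → Fin n → Bool) → Fin n → Fin n → Set
IsBridge R a b = ¬ Walk (deleteEdge R a b) full a b

≟-refl : ∀ {n} (x : Fin n) → ⌊ x ≟ x ⌋ ≡ true
≟-refl x with x ≟ x
... | yes _   = refl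
... | no x≢x = ⊥-elim (x≢x refl)

≟-sound : ∀ {n} {x y : Fin n} → ⌊ x ≟ y ⌋ ≡ true → x ≡ y
≟-sound {x = x} {y} p with x ≟ y
... | yes x≡y = x≡y

∧-≟-false : ∀ {n} {x y a b : Fin n} → ¬ (x ≡ a × y ≡ b) → ⌊ x ≟ a ⌋ ∧ ⌊ y ≟ b ⌋ ≡ false
∧-≟-false {x = x} {y} {a} {b} ne with x ≟ a | y ≟ b
... | yes refl | yes refl = ⊥-elim (ne (refl , refl))
... | yes _    | no _     = refl
... | no _     | _        = refl

module _ {n} (R : Fin n → Fin n → Bool) where

  deleteEdge⇒adj : ∀ {a b x y} → deleteEdge R a b x y ≡ true → R x y ≡ true
  deleteEdge⇒adj = ∧-conicalˡ _ _

  deleteEdge-intro : ∀ {a b x y} → R x y ≡ true → ¬ (x ≡ a × y ≡ b) → ¬ (x ≡ b × y ≡ a) →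
                     deleteEdge R a b x y ≡ true
  deleteEdge-intro e ne₁ ne₂ rewrite e | ∧-≟-false ne₁ | ∧-≟-false ne₂ = refl

  deleteEdge-comm : ∀ a b x y → deleteEdge R a b x y ≡ deleteEdge R b a x y
  deleteEdge-comm a b x y = cong (λ c → R x y ∧ not c) (∨-comm (⌊ x ≟ a ⌋ ∧ ⌊ y ≟ b ⌋) _)

  deleteEdge-sym : (∀ x y → R x y ≡ R y x) → ∀ a b x y → deleteEdge R a b x y ≡ deleteEdge R a b y x
  deleteEdge-sym R-sym a b x y =
    cong₂ (λ r c → r ∧ not c) (R-sym x y)
          (trans (∨-comm (⌊ x ≟ a ⌋ ∧ ⌊ y ≟ b ⌋) _)
                 (cong₂ _∨_ (∧-comm ⌊ x ≟ b ⌋ _) (∧-comm ⌊ x ≟ a ⌋ _)))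

  deleteEdge-removes : ∀ a b → deleteEdge R a b a b ≡ false
  deleteEdge-removes a b with a ≟ a | b ≟ b
  ... | yes _ | yes _ = ∧-zeroʳ (R a b)
  ... | no a≢a | _    = ⊥-elim (a≢a refl)
  ... | _ | no b≢b    = ⊥-elim (b≢b refl)

  deleteEdge-excludes : ∀ {a b x y} → deleteEdge R a b x y ≡ true →
                        ¬ (x ≡ a × y ≡ b) × ¬ (x ≡ b × y ≡ a)
  deleteEdge-excludes {a} {b} d =
      (λ { (refl , refl) → removed (deleteEdge-removes a b) d })
    , (λ { (refl , refl) → removed (trans (deleteEdge-comm a b b a) (deleteEdge-removes b a)) d })
    where
      removed : ∀ {c} → c ≡ false → c ≡ true → ⊥
      removed refl ()

module _ {n} {R : Fin n → Fin n → Bool} {P : VSet n} where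

  walk-start : ∀ {x y} → Walk R P x y → P x ≡ true
  walk-start (here p)     = p
  walk-start (step p _ _) = p

  _++ʷ_ : ∀ {x y z} → Walk R P x y → Walk R P y z → Walk R P x z
  here _       ++ʷ V = V
  step p e W   ++ʷ V = step p e (W ++ʷ V)

  reverseʷ : (∀ x y → R x y ≡ R y x) → ∀ {x y} → Walk R P x y → Walk R P y x
  reverseʷ R-sym (here p)                = here p
  reverseʷ R-sym (step {u} {w} p e W) =
    reverseʷ R-sym W ++ʷ step (walk-start W) (trans (R-sym w u) e) (here p)

  walk-invariant : ∀ {A : Set} (f : Fin n → A) → (∀ x y → R x y ≡ true → f x ≡ f y) →
                   ∀ {x y} → Walk R P x y → f x ≡ f y
  walk-invariant f pres (here _)              = refl
  walk-invariant f pres (step {u} {w} _ e W) = trans (pres u w e) (walk-invariant f pres W)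

  walk-map : ∀ {n'} {R' : Fin n' → Fin n' → Bool} {Q : VSet n'} (f : Fin n → Fin n') →
             (∀ x → P x ≡ true → Q (f x) ≡ true) → (∀ x y → R x y ≡ true → R' (f x) (f y) ≡ true) →
             ∀ {x y} → Walk R P x y → Walk R' Q (f x) (f y)
  walk-map f fP fR (here p)              = here (fP _ p)
  walk-map f fP fR (step {u} {w} p e W) = step (fP u p) (fR u w e) (walk-map f fP fR W)

  walk-collapse : ∀ {n'} {R' : Fin n' → Fin n' → Bool} (f : Fin n → Fin n') →
                  (∀ x y → R x y ≡ true → f x ≡ f y ⊎ R' (f x) (f y) ≡ true) →
                  ∀ {x y} → Walk R P x y → Walk R' full (f x) (f y)
  walk-collapse f fR (here _) = here refl
  walk-collapse {R' = R'} f fR (step {u} {w} {v} _ e W) with fR u w e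
  ... | inj₁ fu≡fw = subst (λ z → Walk R' full z (f v)) (sym fu≡fw) (walk-collapse f fR W)
  ... | inj₂ e'    = step refl e' (walk-collapse f fR W)

iterate-+ : ∀ {A : Set} (f : A → A) i j x → iterate f x (i + j) ≡ iterate f (iterate f x i) j
iterate-+ f zero    j x = refl
iterate-+ f (suc i) j x = iterate-+ f i j (f x)

adj-≢ : ∀ {n} (G : Graph n) {x y} → adj G x y ≡ true → x ≢ y
adj-≢ G {x} e refl with () ← trans (sym e) (irrefl G x)

module TreeFacts {k} (T : Graph k) (tree : IsTree T) where

  Beyond : Fin k → Fin k → Fin k → Set
  Beyond t t' x = Walk (deleteEdge (adj T) t t') full x t'

  ¬beyond-self : ∀ {t t'} → adj T t t' ≡ true → ¬ Beyond t t' t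
  ¬beyond-self = proj₂ tree _ _

  beyond-both : ∀ {t t' x} → adj T t t' ≡ true → Beyond t t' x → Beyond t' t x → ⊥
  beyond-both {t} {t'} {x} e far near = ¬beyond-self e (back ++ʷ far)
    where
      back : Walk (deleteEdge (adj T) t t') full t x
      back = reverseʷ (deleteEdge-sym (adj T) (Graph.sym T) t t')
               (walk-map id (λ _ p → p) (λ x y → trans (sym (deleteEdge-comm (adj T) t' t x y))) near)

  towards : ∀ {P x t} → Walk (adj T) P x t → x ≡ t ⊎ ∃ λ t' → adj T t t' ≡ true × Beyond t t' x
  towards (here _) = inj₁ refl
  towards {t = t} (step {x} {w} _ e W) with towards W
  ... | inj₁ refl = inj₂ (x , trans (Graph.sym T w x) e , here refl)
  ... | inj₂ (t' , e' , far) with x ≟ t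
  ...   | yes x≡t = inj₁ x≡t
  ...   | no x≢t  = inj₂ (t' , e' , step refl (deleteEdge-intro (adj T) e (x≢t ∘ proj₁) notBack) far)
    where
      notBack : ¬ (x ≡ t' × w ≡ t)
      notBack (_ , refl) = ¬beyond-self e' far

  beyond-shift : ∀ {t t' t'' x} → adj T t t' ≡ true → adj T t' t'' ≡ true → t'' ≢ t →
                 Beyond t' t'' x → Beyond t t' x
  beyond-shift {t} {t'} {t''} e e' t''≢t far =
    avoid far ++ʷ step refl (deleteEdge-intro (adj T) (trans (Graph.sym T t'' t') e')
                                (t''≢t ∘ proj₁) (λ (_ , t'≡t) → adj-≢ T e (sym t'≡t)))
                            (here refl)
    where
      never-t' : ∀ {z} → Walk (deleteEdge (adj T) t' t'') full z t'' → z ≢ t'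
      never-t' W refl = ¬beyond-self e' W

      avoid : ∀ {z} → Walk (deleteEdge (adj T) t' t'') full z t'' → Walk (deleteEdge (adj T) t t') full z t''
      avoid (here p)     = here p
      avoid (step p d W) =
        step p (deleteEdge-intro (adj T) (deleteEdge⇒adj (adj T) d)
                                 (never-t' W ∘ proj₂) (never-t' (step p d W) ∘ proj₁))
             (avoid W)

  beyond-along : ∀ {P t t' x y} → Walk (adj T) P y x → (∀ z → P z ≡ true → z ≢ t) →
                 Beyond t t' x → Beyond t t' y
  beyond-along (here _) avoids far = far
  beyond-along (step {u} {w} p e W) avoids far =
    step refl (deleteEdge-intro (adj T) e (avoids u p ∘ proj₁) (avoids w (walk-start W) ∘ proj₂))
         (beyond-along W avoids far)

  -- The iterates of next keep moving beyond the edge just crossed, so they never repeat.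
  nonBacktracking-impossible : (next : Fin k → Fin k) → (∀ t → adj T t (next t) ≡ true) →
                               (∀ t → next (next t) ≢ t) → ¬ Fin k
  nonBacktracking-impossible next adjacent turns t₀
    with i , j , i<j , same ← pigeonhole (n<1+n k) (λ i → iterate next t₀ (toℕ i))
    with o , i+1+o≡j ← m≤n⇒∃[o]m+o≡n i<j
    = noReturn o (iterate next t₀ (toℕ i)) returns
    where
      walkAway : ∀ d t → Beyond t (next t) (iterate next t (suc d))
      walkAway zero    t = here refl
      walkAway (suc d) t = beyond-shift (adjacent t) (adjacent (next t)) (turns t) (walkAway d (next t))

      noReturn : ∀ d t → iterate next t (suc d) ≢ t
      noReturn d t eq = ¬beyond-self (adjacent t) (subst (Beyond t (next t)) eq (walkAway d t))

      open ≡-Reasoning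
      returns : iterate next (iterate next t₀ (toℕ i)) (suc o) ≡ iterate next t₀ (toℕ i)
      returns = begin
        iterate next (iterate next t₀ (toℕ i)) (suc o) ≡⟨ sym (iterate-+ next (toℕ i) (suc o) t₀) ⟩
        iterate next t₀ (toℕ i + suc o)                ≡⟨ cong (iterate next t₀) (trans (+-suc (toℕ i) o) i+1+o≡j) ⟩
        iterate next t₀ (toℕ j)                        ≡⟨ sym same ⟩
        iterate next t₀ (toℕ i)                        ∎

  choice-backtracks : (next : Fin k → Fin k) → (∀ t → adj T t (next t) ≡ true) →
                      Fin k → ∃ λ t → next (next t) ≡ t
  choice-backtracks next adjacent t₀ with any? (λ t → next (next t) ≟ t)
  ... | yes found = found
  ... | no none   = ⊥-elim (nonBacktracking-impossible next adjacent (λ t eq → none (t , eq)) t₀)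

record _⊑ᴳ_ {p n} (G : Graph p) (K : Graph n) : Set where
  field
    embed     : Fin p → Fin n
    injective : ∀ {x y} → embed x ≡ embed y → x ≡ y
    adj-embed : ∀ x y → adj K (embed x) (embed y) ≡ adj G x y
open _⊑ᴳ_

≟-injective : ∀ {p n} (f : Fin p → Fin n) → (∀ {x y} → f x ≡ f y → x ≡ y) →
              ∀ x y → ⌊ f x ≟ f y ⌋ ≡ ⌊ x ≟ y ⌋
≟-injective f inj x y with x ≟ y | f x ≟ f y
... | yes refl | yes _      = refl
... | yes refl | no fx≢fx  = ⊥-elim (fx≢fx refl)
... | no x≢y   | yes fx≡fy = ⊥-elim (x≢y (inj fx≡fy))
... | no _     | no _       = refl

module _ {p n} {G : Graph p} {K : Graph n} (E : G ⊑ᴳ K) where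

  private
    e : Fin p → Fin n
    e = embed E

  deleteEdge-embed : ∀ a b x y → deleteEdge (adj K) (e a) (e b) (e x) (e y) ≡ deleteEdge (adj G) a b x y
  deleteEdge-embed a b x y =
    cong₂ (λ r c → r ∧ not c) (adj-embed E x y)
          (cong₂ _∨_ (cong₂ _∧_ (same x a) (same y b)) (cong₂ _∧_ (same x b) (same y a)))
    where
      same : ∀ u v → ⌊ e u ≟ e v ⌋ ≡ ⌊ u ≟ v ⌋
      same = ≟-injective e (injective E)

  walk-embed : ∀ {P : VSet p} {Q : VSet n} → (∀ x → P x ≡ true → Q (e x) ≡ true) →
               ∀ {x y} → Walk (adj G) P x y → Walk (adj K) Q (e x) (e y)
  walk-embed PQ = walk-map e PQ (λ x y → trans (adj-embed E x y))

  restrictCover : ∀ {X c} → CliqueCover K X c → CliqueCover G (X ∘ e) c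
  restrictCover (C , clique , covers , within) =
      (λ i → C i ∘ e)
    , (λ i x y Cx Cy x≢y → trans (sym (adj-embed E x y)) (clique i (e x) (e y) Cx Cy (x≢y ∘ injective E)))
    , (λ v → covers (e v))
    , (λ v → within (e v))

  restrictDecomposition : TreeDecomposition K → TreeDecomposition G
  restrictDecomposition D = record
    { k = k D ; T = T D ; isTree = isTree D
    ; bag           = λ t → bag D t ∘ e
    ; vertexCovered = λ u → vertexCovered D (e u)
    ; edgeCovered   = λ u v uv → edgeCovered D (e u) (e v) (trans (adj-embed E u v) uv)
    ; subtree       = λ u → subtree D (e u)
    }

  restrictWidth : ∀ {w} → HasAugTDWidth≤ K w → HasAugTDWidth≤ G w
  restrictWidth (D , width) =
    restrictDecomposition D , λ t → Prod.map₂ (Prod.map₂ restrictCover) (width t)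

  tcl≤width : ∀ {a w} → IsTcl G a → HasAugTDWidth≤ K w → a ≤ w
  tcl≤width tcl W = proj₂ tcl _ (restrictWidth W)

  vcc≤cover : ∀ {X c c'} → IsVcc G c → (∀ u → X (e u) ≡ true) → CliqueCover K X c' → c ≤ c'
  vcc≤cover vcc X⊇G cover with C , clique , covers , _ ← restrictCover cover =
    proj₂ vcc _ (C , clique , (λ v _ → covers v (X⊇G v)) , λ _ _ _ → refl)

module _ {m n} (K : Graph (m + n)) (R : Fin m ⊎ Fin n → Fin m ⊎ Fin n → Bool)
         (K-adj : ∀ x y → adj K x y ≡ R (splitAt m x) (splitAt m y)) where

  ↑ˡ-⊑ : ∀ {G : Graph m} → (∀ a b → R (inj₁ a) (inj₁ b) ≡ adj G a b) → G ⊑ᴳ K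
  ↑ˡ-⊑ R-G = record
    { embed     = _↑ˡ n
    ; injective = ↑ˡ-injective n _ _
    ; adj-embed = λ a b → trans (K-adj _ _) (trans (cong₂ R (splitAt-↑ˡ m a n) (splitAt-↑ˡ m b n)) (R-G a b))
    }

  ↑ʳ-⊑ : ∀ {H : Graph n} → (∀ a b → R (inj₂ a) (inj₂ b) ≡ adj H a b) → H ⊑ᴳ K
  ↑ʳ-⊑ R-H = record
    { embed     = m ↑ʳ_
    ; injective = ↑ʳ-injective m _ _
    ; adj-embed = λ a b → trans (K-adj _ _) (trans (cong₂ R (splitAt-↑ʳ m n a) (splitAt-↑ʳ m n b)) (R-H a b))
    }

module _ {m n} (G : Graph m) (H : Graph n) (β : Bool) where

  inl-⊑ : G ⊑ᴳ glue G H β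
  inl-⊑ = ↑ˡ-⊑ (glue G H β) (combine (adj G) (adj H) β) (λ _ _ → refl) (λ _ _ → refl)

  inr-⊑ : H ⊑ᴳ glue G H β
  inr-⊑ = ↑ʳ-⊑ (glue G H β) (combine (adj G) (adj H) β) (λ _ _ → refl) (λ _ _ → refl)

splitAt-injective : ∀ m {n} {x y : Fin (m + n)} → splitAt m x ≡ splitAt m y → x ≡ y
splitAt-injective m {n} {x} {y} eq =
  trans (sym (join-splitAt m n x)) (trans (cong (join m n) eq) (join-splitAt m n y))

swap-injective : ∀ {A B : Set} {x y : A ⊎ B} → swap x ≡ swap y → x ≡ y
swap-injective {x = x} {y} eq = trans (sym (swap-involutive x)) (trans (cong swap eq) (swap-involutive y))

combine-swap : ∀ {m n} (g : Fin m → Fin m → Bool) (h : Fin n → Fin n → Bool) β z w →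
               combine h g β (swap z) (swap w) ≡ combine g h β z w
combine-swap g h β (inj₁ _) (inj₁ _) = refl
combine-swap g h β (inj₁ _) (inj₂ _) = refl
combine-swap g h β (inj₂ _) (inj₁ _) = refl
combine-swap g h β (inj₂ _) (inj₂ _) = refl

glue-swap-⊑ : ∀ {m n} {G : Graph m} {H : Graph n} {β} → glue G H β ⊑ᴳ glue H G β
glue-swap-⊑ {m} {n} {G} {H} {β} = record
  { embed     = join n m ∘ swap ∘ splitAt m
  ; injective = λ eq → splitAt-injective m (swap-injective
                  (trans (sym (splitAt-join n m _)) (trans (cong (splitAt n) eq) (splitAt-join n m _))))
  ; adj-embed = λ x y → trans (cong₂ (combine (adj H) (adj G) β) (splitAt-join n m (swap (splitAt m x)))
                                                                   (splitAt-join n m (swap (splitAt m y))))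
                              (combine-swap (adj G) (adj H) β (splitAt m x) (splitAt m y))
  }

×ᴳ-complete : ∀ {m n} (G : Graph m) (H : Graph n) u w → adj (G ×ᴳ H) (u ↑ˡ n) (m ↑ʳ w) ≡ true
×ᴳ-complete {m} {n} G H u w = cong₂ (combine (adj G) (adj H) true) (splitAt-↑ˡ m u n) (splitAt-↑ʳ m n w)

-- Two trees linked by an edge

-- Projecting by π turns a walk avoiding the edge (e a)(e b) into one avoiding ab.
retract-isBridge : ∀ {k k'} {T : Graph k} {T' : Graph k'} (E : T ⊑ᴳ T') (π : Fin k' → Fin k) →
  (∀ x → π (embed E x) ≡ x) →
  (∀ x y → adj T' x y ≡ true → π x ≡ π y ⊎ ∃₂ λ c d → x ≡ embed E c × y ≡ embed E d) →
  ∀ {a b} → IsBridge (adj T) a b → IsBridge (adj T') (embed E a) (embed E b)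
retract-isBridge {T = T} {T'} E π π-embed collapse {a} {b} bridgeT W =
  bridgeT (subst₂ (Walk (deleteEdge (adj T) a b) full) (π-embed a) (π-embed b) (walk-collapse π project W))
  where
    project : ∀ x y → deleteEdge (adj T') (embed E a) (embed E b) x y ≡ true →
              π x ≡ π y ⊎ deleteEdge (adj T) a b (π x) (π y) ≡ true
    project x y d with collapse x y (deleteEdge⇒adj (adj T') d)
    ... | inj₁ πx≡πy            = inj₁ πx≡πy
    ... | inj₂ (c , c' , refl , refl) =
      inj₂ (subst₂ (λ u v → deleteEdge (adj T) a b u v ≡ true) (sym (π-embed c)) (sym (π-embed c'))
                   (trans (sym (deleteEdge-embed E a b c c')) d))

-- side is constant along any walk avoiding the only edge pq across the cut.
crossing-isBridge : ∀ {k} {R : Fin k → Fin k → Bool} {p q} (side : Fin k → Bool) → side p ≢ side q →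
  (∀ x y → R x y ≡ true → side x ≢ side y → (x ≡ p × y ≡ q) ⊎ (x ≡ q × y ≡ p)) →
  IsBridge R p q
crossing-isBridge {R = R} {p} {q} side p≁q only W = p≁q (walk-invariant side preserved W)
  where
    preserved : ∀ x y → deleteEdge R p q x y ≡ true → side x ≡ side y
    preserved x y d with side x Bool.≟ side y
    ... | yes same = same
    ... | no differ with only x y (deleteEdge⇒adj R d) differ
    ...   | inj₁ pq = ⊥-elim (proj₁ (deleteEdge-excludes R d) pq)
    ...   | inj₂ qp = ⊥-elim (proj₂ (deleteEdge-excludes R d) qp)

module _ {k₁ k₂} (T₁ : Graph k₁) (r₁ : Fin k₁) (T₂ : Graph k₂) (r₂ : Fin k₂) where

  linkAdj : Fin k₁ ⊎ Fin k₂ → Fin k₁ ⊎ Fin k₂ → Bool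
  linkAdj (inj₁ a) (inj₁ b) = adj T₁ a b
  linkAdj (inj₂ a) (inj₂ b) = adj T₂ a b
  linkAdj (inj₁ a) (inj₂ b) = ⌊ a ≟ r₁ ⌋ ∧ ⌊ b ≟ r₂ ⌋
  linkAdj (inj₂ a) (inj₁ b) = ⌊ b ≟ r₁ ⌋ ∧ ⌊ a ≟ r₂ ⌋

  private
    linkAdj-sym : ∀ x y → linkAdj x y ≡ linkAdj y x
    linkAdj-sym (inj₁ a) (inj₁ b) = Graph.sym T₁ a b
    linkAdj-sym (inj₂ a) (inj₂ b) = Graph.sym T₂ a b
    linkAdj-sym (inj₁ a) (inj₂ b) = refl
    linkAdj-sym (inj₂ a) (inj₁ b) = refl

    linkAdj-irrefl : ∀ x → linkAdj x x ≡ false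
    linkAdj-irrefl (inj₁ a) = irrefl T₁ a
    linkAdj-irrefl (inj₂ a) = irrefl T₂ a

  linkTrees : Graph (k₁ + k₂)
  linkTrees = record
    { adj    = λ x y → linkAdj (splitAt k₁ x) (splitAt k₁ y)
    ; sym    = λ x y → linkAdj-sym (splitAt k₁ x) (splitAt k₁ y)
    ; irrefl = λ x → linkAdj-irrefl (splitAt k₁ x)
    }

module LinkTrees {k₁ k₂} {T₁ : Graph k₁} {T₂ : Graph k₂} (tree₁ : IsTree T₁) (tree₂ : IsTree T₂)
              (r₁ : Fin k₁) (r₂ : Fin k₂) where

  B : Graph (k₁ + k₂)
  B = linkTrees T₁ r₁ T₂ r₂

  T₁-⊑ : T₁ ⊑ᴳ B
  T₁-⊑ = ↑ˡ-⊑ B (linkAdj T₁ r₁ T₂ r₂) (λ _ _ → refl) (λ _ _ → refl)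

  T₂-⊑ : T₂ ⊑ᴳ B
  T₂-⊑ = ↑ʳ-⊑ B (linkAdj T₁ r₁ T₂ r₂) (λ _ _ → refl) (λ _ _ → refl)

  private
    p q : Fin (k₁ + k₂)
    p = r₁ ↑ˡ k₂
    q = k₁ ↑ʳ r₂

    link : adj B q p ≡ true
    link rewrite splitAt-↑ʳ k₁ k₂ r₂ | splitAt-↑ˡ k₁ r₁ k₂ | ≟-refl r₁ | ≟-refl r₂ = refl

    toRoot : ∀ t → Walk (adj B) full t p
    toRoot t with splitAt k₁ t in eq
    ... | inj₁ s = subst (λ x → Walk (adj B) full x p) (splitAt⁻¹-↑ˡ eq)
                     (walk-embed T₁-⊑ (λ _ _ → refl) (proj₁ tree₁ s r₁ refl refl))
    ... | inj₂ s = subst (λ x → Walk (adj B) full x p) (splitAt⁻¹-↑ʳ eq)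
                     (walk-embed T₂-⊑ (λ _ _ → refl) (proj₁ tree₂ s r₂ refl refl) ++ʷ step refl link (here refl))

    linkEnds : ∀ {c d} → linkAdj T₁ r₁ T₂ r₂ (inj₁ c) (inj₂ d) ≡ true → c ≡ r₁ × d ≡ r₂
    linkEnds {c} e = ≟-sound (∧-conicalˡ _ _ e) , ≟-sound (∧-conicalʳ ⌊ c ≟ r₁ ⌋ _ e)

    isLeft : Fin k₁ ⊎ Fin k₂ → Bool
    isLeft = [ const true , const false ]′

    onLeft : Fin (k₁ + k₂) → Bool
    onLeft = isLeft ∘ splitAt k₁

    crossingᶻ : ∀ zx zy → linkAdj T₁ r₁ T₂ r₂ zx zy ≡ true → isLeft zx ≢ isLeft zy →
                (zx ≡ inj₁ r₁ × zy ≡ inj₂ r₂) ⊎ (zx ≡ inj₂ r₂ × zy ≡ inj₁ r₁)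
    crossingᶻ (inj₁ a) (inj₁ b) _ differ = ⊥-elim (differ refl)
    crossingᶻ (inj₂ a) (inj₂ b) _ differ = ⊥-elim (differ refl)
    crossingᶻ (inj₁ a) (inj₂ b) e _ = inj₁ (Prod.map (cong inj₁) (cong inj₂) (linkEnds e))
    crossingᶻ (inj₂ a) (inj₁ b) e _ = inj₂ (Prod.swap (Prod.map (cong inj₁) (cong inj₂) (linkEnds e)))

    crossing : ∀ x y → adj B x y ≡ true → onLeft x ≢ onLeft y → (x ≡ p × y ≡ q) ⊎ (x ≡ q × y ≡ p)
    crossing x y e differ =
      Sum.map (Prod.map (sym ∘ splitAt⁻¹-↑ˡ) (sym ∘ splitAt⁻¹-↑ʳ))
              (Prod.map (sym ∘ splitAt⁻¹-↑ʳ) (sym ∘ splitAt⁻¹-↑ˡ))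
              (crossingᶻ (splitAt k₁ x) (splitAt k₁ y) e differ)

    p≁q : onLeft p ≢ onLeft q
    p≁q same
      with () ← trans (sym (cong isLeft (splitAt-↑ˡ k₁ r₁ k₂))) (trans same (cong isLeft (splitAt-↑ʳ k₁ k₂ r₂)))

    πˡ : Fin k₁ ⊎ Fin k₂ → Fin k₁
    πˡ = [ id , const r₁ ]′

    πʳ : Fin k₁ ⊎ Fin k₂ → Fin k₂
    πʳ = [ const r₂ , id ]′

    collapseˡ : ∀ zx zy → linkAdj T₁ r₁ T₂ r₂ zx zy ≡ true →
                πˡ zx ≡ πˡ zy ⊎ ∃₂ λ c d → zx ≡ inj₁ c × zy ≡ inj₁ d
    collapseˡ (inj₁ a) (inj₁ b) _ = inj₂ (a , b , refl , refl)
    collapseˡ (inj₂ a) (inj₂ b) _ = inj₁ refl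
    collapseˡ (inj₁ a) (inj₂ b) e = inj₁ (proj₁ (linkEnds e))
    collapseˡ (inj₂ a) (inj₁ b) e = inj₁ (sym (proj₁ (linkEnds e)))

    collapseʳ : ∀ zx zy → linkAdj T₁ r₁ T₂ r₂ zx zy ≡ true →
                πʳ zx ≡ πʳ zy ⊎ ∃₂ λ c d → zx ≡ inj₂ c × zy ≡ inj₂ d
    collapseʳ (inj₂ a) (inj₂ b) _ = inj₂ (a , b , refl , refl)
    collapseʳ (inj₁ a) (inj₁ b) _ = inj₁ refl
    collapseʳ (inj₁ a) (inj₂ b) e = inj₁ (sym (proj₂ (linkEnds e)))
    collapseʳ (inj₂ a) (inj₁ b) e = inj₁ (proj₂ (linkEnds e))

    T₁-bridges : ∀ {a b} → IsBridge (adj T₁) a b → IsBridge (adj B) (a ↑ˡ k₂) (b ↑ˡ k₂)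
    T₁-bridges = retract-isBridge T₁-⊑ (πˡ ∘ splitAt k₁) (λ c → cong πˡ (splitAt-↑ˡ k₁ c k₂))
      λ x y e → Sum.map₂ (λ (c , d , ex , ey) → c , d , sym (splitAt⁻¹-↑ˡ ex) , sym (splitAt⁻¹-↑ˡ ey))
                         (collapseˡ (splitAt k₁ x) (splitAt k₁ y) e)

    T₂-bridges : ∀ {a b} → IsBridge (adj T₂) a b → IsBridge (adj B) (k₁ ↑ʳ a) (k₁ ↑ʳ b)
    T₂-bridges = retract-isBridge T₂-⊑ (πʳ ∘ splitAt k₁) (λ c → cong πʳ (splitAt-↑ʳ k₁ k₂ c))
      λ x y e → Sum.map₂ (λ (c , d , ex , ey) → c , d , sym (splitAt⁻¹-↑ʳ ex) , sym (splitAt⁻¹-↑ʳ ey))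
                         (collapseʳ (splitAt k₁ x) (splitAt k₁ y) e)

    link-bridges : ∀ {x y} → (x ≡ p × y ≡ q) ⊎ (x ≡ q × y ≡ p) → IsBridge (adj B) x y
    link-bridges (inj₁ (refl , refl)) = crossing-isBridge onLeft p≁q crossing
    link-bridges (inj₂ (refl , refl)) =
      crossing-isBridge onLeft (p≁q ∘ sym) (λ x y e → Sum.swap ∘ crossing x y e)

    bridges : ∀ a b → adj B a b ≡ true → IsBridge (adj B) a b
    bridges a b e with splitAt k₁ a in ea | splitAt k₁ b in eb
    ... | inj₁ c | inj₁ d =
      subst₂ (IsBridge (adj B)) (splitAt⁻¹-↑ˡ ea) (splitAt⁻¹-↑ˡ eb) (T₁-bridges (proj₂ tree₁ c d e))
    ... | inj₂ c | inj₂ d =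
      subst₂ (IsBridge (adj B)) (splitAt⁻¹-↑ʳ ea) (splitAt⁻¹-↑ʳ eb) (T₂-bridges (proj₂ tree₂ c d e))
    ... | inj₁ c | inj₂ d with refl , refl ← linkEnds {c} {d} e =
      link-bridges (inj₁ (sym (splitAt⁻¹-↑ˡ ea) , sym (splitAt⁻¹-↑ʳ eb)))
    ... | inj₂ c | inj₁ d with refl , refl ← linkEnds {d} {c} e =
      link-bridges (inj₂ (sym (splitAt⁻¹-↑ʳ ea) , sym (splitAt⁻¹-↑ˡ eb)))

  linkTrees-isTree : IsTree B
  linkTrees-isTree = (λ x y _ _ → toRoot x ++ʷ reverseʷ (Graph.sym B) (toRoot y)) , bridges

-- Clique covers and decompositions of disjoint unions and joins

emptyCover : ∀ {n} {K : Graph n} c → CliqueCover K (const false) c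
emptyCover c = (λ _ _ → false) , (λ _ _ _ ()) , (λ _ ()) , (λ _ _ ())

cover-+ : ∀ {n} {K : Graph n} {X c} r → CliqueCover K X c → CliqueCover K X (c + r)
cover-+ {K = K} {X} {c} r (C , clique , covers , within) =
    C' ∘ splitAt c
  , clique' ∘ splitAt c
  , (λ v v∈X → Prod.map (_↑ˡ r) (subst (λ z → C' z v ≡ true) (sym (splitAt-↑ˡ c _ r))) (covers v v∈X))
  , (λ v i → within' v (splitAt c i))
  where
    C' : Fin c ⊎ Fin r → VSet _
    C' = [ C , const (const false) ]′
    clique' : ∀ z → IsClique K (C' z)
    clique' (inj₁ i) = clique i
    clique' (inj₂ _) _ _ ()
    within' : ∀ v z → C' z v ≡ true → X v ≡ true
    within' v (inj₁ i) = within v i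

cover-weaken : ∀ {n} {K : Graph n} {X c c'} → c ≤ c' → CliqueCover K X c → CliqueCover K X c'
cover-weaken {K = K} {X} {c} {c'} c≤c' cover =
  subst (CliqueCover K X) (m+[n∸m]≡n c≤c') (cover-+ {K = K} {X} (c' ∸ c) cover)

glueCover : ∀ {m n} {G : Graph m} {H : Graph n} β {X Y c} (CX : CliqueCover G X c) (CY : CliqueCover H Y c) →
            (∀ i x y → proj₁ CX i x ≡ true → proj₁ CY i y ≡ true → β ≡ true) →
            CliqueCover (glue G H β) ([ X , Y ]′ ∘ splitAt m) c
glueCover {m} {n} {G} {H} β {X} {Y} (C , clique , covers , within) (C' , clique' , covers' , within') mixed =
    (λ i → [ C i , C' i ]′ ∘ splitAt m)
  , (λ i x y x∈ y∈ x≢y → cliqueᶻ i (splitAt m x) (splitAt m y) x∈ y∈ (x≢y ∘ splitAt-injective m))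
  , coversᶻ ∘ splitAt m
  , (λ v i → withinᶻ i (splitAt m v))
  where
    cliqueᶻ : ∀ i zx zy → [ C i , C' i ]′ zx ≡ true → [ C i , C' i ]′ zy ≡ true → zx ≢ zy →
              combine (adj G) (adj H) β zx zy ≡ true
    cliqueᶻ i (inj₁ x) (inj₁ y) x∈ y∈ x≢y = clique i x y x∈ y∈ (x≢y ∘ cong inj₁)
    cliqueᶻ i (inj₂ x) (inj₂ y) x∈ y∈ x≢y = clique' i x y x∈ y∈ (x≢y ∘ cong inj₂)
    cliqueᶻ i (inj₁ x) (inj₂ y) x∈ y∈ _   = mixed i x y x∈ y∈
    cliqueᶻ i (inj₂ x) (inj₁ y) x∈ y∈ _   = mixed i y x y∈ x∈
    coversᶻ : ∀ z → [ X , Y ]′ z ≡ true → ∃ λ i → [ C i , C' i ]′ z ≡ true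
    coversᶻ (inj₁ x) = covers x
    coversᶻ (inj₂ y) = covers' y
    withinᶻ : ∀ i z → [ C i , C' i ]′ z ≡ true → [ X , Y ]′ z ≡ true
    withinᶻ i (inj₁ x) = within x i
    withinᶻ i (inj₂ y) = within' y i

width-⊓ : ∀ {n} {K : Graph n} {x y} → HasAugTDWidth≤ K x → HasAugTDWidth≤ K y → HasAugTDWidth≤ K (x ⊓ y)
width-⊓ {K = K} {x} {y} Wx Wy with ⊓-sel x y
... | inj₁ x⊓y≡x = subst (HasAugTDWidth≤ K) (sym x⊓y≡x) Wx
... | inj₂ x⊓y≡y = subst (HasAugTDWidth≤ K) (sym x⊓y≡y) Wy

module DisjointUnion {m n} {G : Graph m} {H : Graph n} (D₁ : TreeDecomposition G) (D₂ : TreeDecomposition H)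
                     (r₁ : Fin (k D₁)) (r₂ : Fin (k D₂)) where

  open LinkTrees {T₁ = T D₁} {T₂ = T D₂} (isTree D₁) (isTree D₂) r₁ r₂

  bagᶻ : Fin (k D₁) ⊎ Fin (k D₂) → Fin m ⊎ Fin n → Bool
  bagᶻ (inj₁ s) = [ bag D₁ s , const false ]′
  bagᶻ (inj₂ s) = [ const false , bag D₂ s ]′

  private
    k₁ k₂ : ℕ
    k₁ = k D₁
    k₂ = k D₂

    atˡ : ∀ {s z} → bagᶻ (inj₁ s) z ≡ true → bagᶻ (splitAt k₁ (s ↑ˡ k₂)) z ≡ true
    atˡ {s} = subst (λ w → bagᶻ w _ ≡ true) (sym (splitAt-↑ˡ k₁ s k₂))

    atʳ : ∀ {s z} → bagᶻ (inj₂ s) z ≡ true → bagᶻ (splitAt k₁ (k₁ ↑ʳ s)) z ≡ true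
    atʳ {s} = subst (λ w → bagᶻ w _ ≡ true) (sym (splitAt-↑ʳ k₁ k₂ s))

    vertexCoveredᶻ : ∀ z → ∃ λ t → bagᶻ (splitAt k₁ t) z ≡ true
    vertexCoveredᶻ (inj₁ x) = Prod.map (_↑ˡ k₂) atˡ (vertexCovered D₁ x)
    vertexCoveredᶻ (inj₂ y) = Prod.map (k₁ ↑ʳ_) atʳ (vertexCovered D₂ y)

    edgeCoveredᶻ : ∀ z z' → combine (adj G) (adj H) false z z' ≡ true →
                   ∃ λ t → bagᶻ (splitAt k₁ t) z ≡ true × bagᶻ (splitAt k₁ t) z' ≡ true
    edgeCoveredᶻ (inj₁ x) (inj₁ y) e = Prod.map (_↑ˡ k₂) (Prod.map atˡ atˡ) (edgeCovered D₁ x y e)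
    edgeCoveredᶻ (inj₂ x) (inj₂ y) e = Prod.map (k₁ ↑ʳ_) (Prod.map atʳ atʳ) (edgeCovered D₂ x y e)

    subtreeᶻ : ∀ z → ConnectedOn (adj B) (λ t → bagᶻ (splitAt k₁ t) z)
    subtreeᶻ (inj₁ x) t t' t∋ t'∋ with splitAt k₁ t in et | splitAt k₁ t' in et'
    subtreeᶻ (inj₁ x) t t' t∋ t'∋ | inj₁ s | inj₁ s' =
      subst₂ (Walk (adj B) _) (splitAt⁻¹-↑ˡ et) (splitAt⁻¹-↑ˡ et')
             (walk-embed T₁-⊑ (λ _ → atˡ) (subtree D₁ x s s' t∋ t'∋))
    subtreeᶻ (inj₂ y) t t' t∋ t'∋ with splitAt k₁ t in et | splitAt k₁ t' in et'
    subtreeᶻ (inj₂ y) t t' t∋ t'∋ | inj₂ s | inj₂ s' =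
      subst₂ (Walk (adj B) _) (splitAt⁻¹-↑ʳ et) (splitAt⁻¹-↑ʳ et')
             (walk-embed T₂-⊑ (λ _ → atʳ) (subtree D₂ y s s' t∋ t'∋))

  decomposition : TreeDecomposition (G ⊎ᴳ H)
  decomposition = record
    { k = k₁ + k₂ ; T = B ; isTree = linkTrees-isTree
    ; bag           = λ t → bagᶻ (splitAt k₁ t) ∘ splitAt m
    ; vertexCovered = vertexCoveredᶻ ∘ splitAt m
    ; edgeCovered   = λ u v → edgeCoveredᶻ (splitAt m u) (splitAt m v)
    ; subtree       = subtreeᶻ ∘ splitAt m
    }

⊎ᴳ-width : ∀ {m n} {G : Graph (suc m)} {H : Graph (suc n)} {a b} →
           HasAugTDWidth≤ G a → HasAugTDWidth≤ H b → HasAugTDWidth≤ (G ⊎ᴳ H) (a ⊔ b)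
⊎ᴳ-width {m} {G = G} {H} {a} {b} (D₁ , width₁) (D₂ , width₂) = decomposition , widthᶻ ∘ splitAt (k D₁)
  where
    open DisjointUnion D₁ D₂ (proj₁ (vertexCovered D₁ zero)) (proj₁ (vertexCovered D₂ zero))
    widthᶻ : ∀ z → Σ ℕ λ c → c ≤ a ⊔ b × CliqueCover (G ⊎ᴳ H) (bagᶻ z ∘ splitAt (suc m)) c
    widthᶻ (inj₁ s) with c , c≤a , cover ← width₁ s =
      c , ≤-trans c≤a (m≤m⊔n a b) , glueCover {G = G} {H} false cover (emptyCover {K = H} c) (λ _ _ _ _ ())
    widthᶻ (inj₂ s) with c , c≤b , cover ← width₂ s =
      c , ≤-trans c≤b (m≤n⊔m a b) , glueCover {G = G} {H} false (emptyCover {K = G} c) cover (λ _ _ _ ())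

joinDecomposition : ∀ {m n} {G : Graph m} {H : Graph n} (D : TreeDecomposition H) → Fin (k D) →
                    TreeDecomposition (G ×ᴳ H)
joinDecomposition {m} {G = G} {H} D t₀ = record
  { k = k D ; T = T D ; isTree = isTree D
  ; bag           = λ t → [ full , bag D t ]′ ∘ splitAt m
  ; vertexCovered = vertexCoveredᶻ ∘ splitAt m
  ; edgeCovered   = λ u v → edgeCoveredᶻ (splitAt m u) (splitAt m v)
  ; subtree       = subtreeᶻ ∘ splitAt m
  }
  where
    vertexCoveredᶻ : ∀ z → ∃ λ t → [ full , bag D t ]′ z ≡ true
    vertexCoveredᶻ (inj₁ _) = t₀ , refl
    vertexCoveredᶻ (inj₂ y) = vertexCovered D y

    edgeCoveredᶻ : ∀ z z' → combine (adj G) (adj H) true z z' ≡ true →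
                   ∃ λ t → [ full , bag D t ]′ z ≡ true × [ full , bag D t ]′ z' ≡ true
    edgeCoveredᶻ (inj₁ _) (inj₁ _) _ = t₀ , refl , refl
    edgeCoveredᶻ (inj₁ _) (inj₂ y) _ = Prod.map₂ (refl ,_) (vertexCovered D y)
    edgeCoveredᶻ (inj₂ x) (inj₁ _) _ = Prod.map₂ (_, refl) (vertexCovered D x)
    edgeCoveredᶻ (inj₂ x) (inj₂ y) e = edgeCovered D x y e

    subtreeᶻ : ∀ z → ConnectedOn (adj (T D)) (λ t → [ full , bag D t ]′ z)
    subtreeᶻ (inj₁ _) t t' _ _ = proj₁ (isTree D) t t' refl refl
    subtreeᶻ (inj₂ y)          = subtree D y

×ᴳ-widthʳ : ∀ {m n} {G : Graph m} {H : Graph (suc n)} {b c} →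
            IsVcc G c → HasAugTDWidth≤ H b → HasAugTDWidth≤ (G ×ᴳ H) (c ⊔ b)
×ᴳ-widthʳ {m} {G = G} {H} {b} {c} vcc (D , width) =
  joinDecomposition {G = G} D (proj₁ (vertexCovered D zero)) , widthAt
  where
    widthAt : ∀ t → Σ ℕ λ c' → c' ≤ c ⊔ b × CliqueCover (G ×ᴳ H) ([ full , bag D t ]′ ∘ splitAt m) c'
    widthAt t with ct , ct≤b , cover ← width t =
        c ⊔ ct
      , ⊔-monoʳ-≤ c ct≤b
      , glueCover {G = G} {H} true (cover-weaken {K = G} (m≤m⊔n c ct) (proj₁ vcc))
                                   (cover-weaken {K = H} (m≤n⊔m c ct) cover) (λ _ _ _ _ _ → refl)

×ᴳ-widthˡ : ∀ {m n} {G : Graph (suc m)} {H : Graph n} {a d} →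
            IsVcc H d → HasAugTDWidth≤ G a → HasAugTDWidth≤ (G ×ᴳ H) (d ⊔ a)
×ᴳ-widthˡ {G = G} {H} vcc W = restrictWidth (glue-swap-⊑ {G = G} {H}) (×ᴳ-widthʳ {G = H} {G} vcc W)

-- Some bag of a decomposition of a join contains a side

module _ {n} {K : Graph n} (D : TreeDecomposition K) where

  open TreeFacts (T D) (isTree D)

  absent-beyond : ∀ {t t' s v} → bag D t v ≡ false → bag D s v ≡ true → Beyond t t' s →
                  ∀ r → bag D r v ≡ true → Beyond t t' r
  absent-beyond {t} {v = v} v∉t v∈s far r v∈r = beyond-along (subtree D v r _ v∈r v∈s) avoids far
    where
      avoids : ∀ z → bag D z v ≡ true → z ≢ t
      avoids z v∈z refl with () ← trans (sym v∈z) v∉t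

  record Exit (t : Fin (k D)) (v w : Fin n) : Set where
    field
      next     : Fin (k D)
      adjacent : adj (T D) t next ≡ true
      beyondᵛ  : ∀ r → bag D r v ≡ true → Beyond t next r
      beyondʷ  : ∀ r → bag D r w ≡ true → Beyond t next r

  edge-exit : ∀ {v w t} → adj K v w ≡ true → bag D t v ≡ false → bag D t w ≡ false → Exit t v w
  edge-exit {v} {w} {t} vw v∉t w∉t
    with s , v∈s , w∈s ← edgeCovered D v w vw
    with towards (proj₁ (isTree D) s t refl refl)
  ... | inj₁ refl with () ← trans (sym v∈s) v∉t
  ... | inj₂ (t' , tt' , far) = record
    { next = t' ; adjacent = tt' ; beyondᵛ = absent-beyond v∉t v∈s far ; beyondʷ = absent-beyond w∉t w∈s far }

  ¬missing-both : ∀ {a b} (eA : Fin a → Fin n) (eB : Fin b → Fin n) → (∀ u w → adj K (eA u) (eB w) ≡ true) →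
                  (∀ t → ∃ λ u → bag D t (eA u) ≡ false) → (∀ t → ∃ λ w → bag D t (eB w) ≡ false) →
                  ¬ Fin (k D)
  ¬missing-both eA eB complete missingA missingB t₀ =
    let t , returns    = choice-backtracks next (Exit.adjacent ∘ exit) t₀
        r , u∈r , w∈r = edgeCovered D _ _ (complete (proj₁ (missingA t)) (proj₁ (missingB (next t))))
    in beyond-both (Exit.adjacent (exit t)) (Exit.beyondᵛ (exit t) r u∈r)
                   (subst (λ t' → Beyond (next t) t' r) returns (Exit.beyondʷ (exit (next t)) r w∈r))
    where
      exit : ∀ t → Exit t (eA (proj₁ (missingA t))) (eB (proj₁ (missingB t)))
      exit t = edge-exit (complete _ _) (proj₂ (missingA t)) (proj₂ (missingB t))

      next : Fin (k D) → Fin (k D)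
      next = Exit.next ∘ exit

  contains? : ∀ {c} (e : Fin c → Fin n) t → Dec (∀ u → bag D t (e u) ≡ true)
  contains? e t = all? (λ u → bag D t (e u) Bool.≟ true)

  bag-⊇-side : ∀ {a b} (eA : Fin a → Fin n) (eB : Fin b → Fin n) → (∀ u w → adj K (eA u) (eB w) ≡ true) →
               Fin (k D) → (∃ λ t → ∀ u → bag D t (eA u) ≡ true) ⊎ (∃ λ t → ∀ w → bag D t (eB w) ≡ true)
  bag-⊇-side eA eB complete t₀ with any? (contains? eA) | any? (contains? eB)
  ... | yes A⊆ | _      = inj₁ A⊆
  ... | no _   | yes B⊆ = inj₂ B⊆
  ... | no A⊈  | no B⊈  = ⊥-elim (¬missing-both eA eB complete (missing eA A⊈) (missing eB B⊈) t₀)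
    where
      missing : ∀ {c} (e : Fin c → Fin n) → ¬ (∃ λ t → ∀ u → bag D t (e u) ≡ true) →
                ∀ t → ∃ λ u → bag D t (e u) ≡ false
      missing {c} e ¬⊆ t = Prod.map₂ ¬-not (¬∀⟶∃¬ c _ (λ u → bag D t (e u) Bool.≟ true) (¬⊆ ∘ (t ,_)))

×ᴳ-tcl-lower : ∀ {m n} {G : Graph (suc m)} {H : Graph (suc n)} {a b c d w} →
               IsTcl G a → IsTcl H b → IsVcc G c → IsVcc H d → HasAugTDWidth≤ (G ×ᴳ H) w →
               (c ⊔ b) ⊓ (d ⊔ a) ≤ w
×ᴳ-tcl-lower {G = G} {H} {a} {b} {c} {d} tclG tclH vccG vccH W@(D , width)
  with bag-⊇-side D (embed (inl-⊑ G H true)) (embed (inr-⊑ G H true)) (×ᴳ-complete G H)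
                    (proj₁ (vertexCovered D zero))
... | inj₁ (t , G⊆) with ct , ct≤w , cover ← width t =
  ≤-trans (m⊓n≤m (c ⊔ b) _) (⊔-lub (≤-trans (vcc≤cover (inl-⊑ G H true) vccG G⊆ cover) ct≤w)
                                    (tcl≤width (inr-⊑ G H true) tclH W))
... | inj₂ (t , H⊆) with ct , ct≤w , cover ← width t =
  ≤-trans (m⊓n≤n _ (d ⊔ a)) (⊔-lub (≤-trans (vcc≤cover (inr-⊑ G H true) vccH H⊆ cover) ct≤w)
                                    (tcl≤width (inl-⊑ G H true) tclG W))

lemma13 : ∀ {m n} (G : Graph (suc m)) (H : Graph (suc n)) →
    (∀ a b → IsTcl G a → IsTcl H b → IsTcl (G ⊎ᴳ H) (a ⊔ b)) ×
    (∀ a b c d → IsTcl G a → IsTcl H b → IsVcc G c → IsVcc H d →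
      IsTcl (G ×ᴳ H) ((c ⊔ b) ⊓ (d ⊔ a)))
lemma13 G H = disjointUnion , joinGraphs
  where
    disjointUnion : ∀ a b → IsTcl G a → IsTcl H b → IsTcl (G ⊎ᴳ H) (a ⊔ b)
    disjointUnion a b tclG tclH =
        ⊎ᴳ-width (proj₁ tclG) (proj₁ tclH)
      , λ w W → ⊔-lub (tcl≤width (inl-⊑ G H false) tclG W) (tcl≤width (inr-⊑ G H false) tclH W)

    joinGraphs : ∀ a b c d → IsTcl G a → IsTcl H b → IsVcc G c → IsVcc H d →
                 IsTcl (G ×ᴳ H) ((c ⊔ b) ⊓ (d ⊔ a))
    joinGraphs a b c d tclG tclH vccG vccH =
        width-⊓ (×ᴳ-widthʳ vccG (proj₁ tclH)) (×ᴳ-widthˡ vccH (proj₁ tclG))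
      , λ w → ×ᴳ-tcl-lower tclG tclH vccG vccH
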